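{- Let $G=(V,E)$ be a finite undirected bi-connected graph with $n=|V|\ge 6$, and let $s_1,s_2\in V$ with $(s_1,s_2)\in E$. Let $C_1,\dots,C_k$ be the connected components of the graph obtained from $G$ by deleting $s_1$, $s_2$ and all edges incident to them, and suppose $k>2$. Suppose $V=V_1\cup V_2$ is a partition into disjoint sets such that $G[V_1]$ and $G[V_2]$ are both bi-connected and $s_1,s_2\in V_1$. Then, after renumbering the components, $V_1$ contains the $k-1$ components $C_1,\dots,C_{k-1}$ and $V_2\subseteq C_k$; moreover, either (I) $V_1=C_1\cup\dots\cup C_{k-1}\cup\{s_1,s_2\}$, $G[V_1]$ is bi-connected, and $G[V_2]=G[C_k]$ is bi-connected; or (II) setting $V_k=C_k\cup\{s_1,s_2\}$, the graph $G[V_k]$ can be partitioned into two bi-connected induced subgraphs $G_k(1)$ and $G_k(2)$ on disjoint vertex sets whose union is $V_k$, with $G_k(2)=G[V_2]$ and $s_1,s_2$ belonging to $G_k(1)$.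
   Context: A graph is bi-connected (2-connected) if it is connected and has no articulation point, i.e. no vertex whose removal disconnects it. For $V'\subseteq V$, $G[V']$ denotes the subgraph of $G$ induced by $V'$. -}

module Defs where

open import Level using (0ℓ)
open import Data.Nat using (ℕ)
open import Data.Fin using (Fin)
open import Data.Bool using (Bool; true)
open import Data.Product using (Σ; _×_; ∃-syntax)
open import Data.Sum using (_⊎_)
open import Relation.Nullary using (¬_)
open import Relation.Binary.PropositionalEquality using (_≡_; _≢_)
open import Relation.Unary using (Pred; _∈_; _∉_)

record Graph (n : ℕ) : Set where
  field
    adj     : Fin n → Fin n → Bool
    adj-sym : ∀ u v → adj u v ≡ true → adj v u ≡ true
    irrefl  : ∀ v → ¬ (adj v v ≡ true)
open Graph public

VSet : ℕ → Set₁
VSet n = Pred (Fin n) 0ℓ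

Univ : ∀ {n} → VSet n
Univ _ = Data.Unit.⊤
  where import Data.Unit

_-ᵥ_ : ∀ {n} → VSet n → Fin n → VSet n
(S -ᵥ x) v = v ∈ S × v ≢ x

data Walk {n} (G : Graph n) (S : VSet n) : Fin n → Fin n → Set where
  here : ∀ {u} → u ∈ S → Walk G S u u
  step : ∀ {u w v} → u ∈ S → adj G u w ≡ true → Walk G S w v → Walk G S u v

AllLinked : ∀ {n} → Graph n → VSet n → Set
AllLinked G S = ∀ u v → u ∈ S → v ∈ S → Walk G S u v

Connected : ∀ {n} → Graph n → VSet n → Set
Connected G S = (∃[ v ] v ∈ S) × AllLinked G S

Articulation : ∀ {n} → Graph n → VSet n → Fin n → Set
Articulation G S x = x ∈ S × ¬ AllLinked G (S -ᵥ x)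

Biconnected : ∀ {n} → Graph n → VSet n → Set
Biconnected G S = Connected G S × (∀ x → ¬ Articulation G S x)

_≐_ : ∀ {n} → VSet n → VSet n → Set
A ≐ B = (∀ v → v ∈ A → v ∈ B) × (∀ v → v ∈ B → v ∈ A)

_⊆_ : ∀ {n} → VSet n → VSet n → Set
A ⊆ B = ∀ v → v ∈ A → v ∈ B

Disjoint : ∀ {n} → VSet n → VSet n → Set
Disjoint A B = ∀ v → v ∈ A → v ∈ B → Data.Empty.⊥
  where import Data.Empty

Rest : ∀ {n} → Fin n → Fin n → VSet n
Rest s₁ s₂ v = v ≢ s₁ × v ≢ s₂

-- comp labels the connected components of G - {s₁,s₂} by Fin k:
-- every label is used, and two remaining vertices get the same label
-- iff they are joined by a walk avoiding s₁ and s₂.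
IsComponentLabelling : ∀ {n} → Graph n → Fin n → Fin n → (k : ℕ) → (Fin n → Fin k) → Set
IsComponentLabelling G s₁ s₂ k comp =
  (∀ i → ∃[ v ] (v ∈ Rest s₁ s₂ × comp v ≡ i)) ×
  (∀ u v → u ∈ Rest s₁ s₂ → v ∈ Rest s₁ s₂ →
     (comp u ≡ comp v → Walk G (Rest s₁ s₂) u v) × (Walk G (Rest s₁ s₂) u v → comp u ≡ comp v))

Comp : ∀ {n k} → Fin n → Fin n → (Fin n → Fin k) → Fin k → VSet n
Comp s₁ s₂ comp i v = v ∈ Rest s₁ s₂ × comp v ≡ i

-- Let W = C_j ∪ {s₁, s₂} (Comp⁺ j), where C_j is the component containing V₂; V₂ is
-- connected and avoids s₁, s₂, so it lies in a single component, and every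
-- other component lies in V₁. A walk inside V₁ that starts in C_j can leave
-- C_j only through s₁ or s₂, so truncating it there keeps it inside V₁ ∩ W.
-- Together with the edge s₁s₂ this shows V₁ ∩ W is connected. The same
-- argument applied to V₁ - x, which still contains s₁ or s₂, shows that
-- V₁ ∩ W has no articulation point. Alternative (II) therefore always holds,
-- with G_k(1) = V₁ ∩ W and G_k(2) = V₂.
module Submission where

open import Defs
open import Data.Nat using (ℕ; _≤_; _<_)
open import Data.Fin using (Fin; _≟_)
open import Data.Bool using (true)
open import Data.Product using (Σ; _×_; ∃-syntax; _,_; proj₁; proj₂)
open import Data.Sum using (_⊎_; inj₁; inj₂; map₁)
open import Data.Empty using (⊥-elim)
open import Relation.Nullary using (yes; no)
open import Relation.Binary.PropositionalEquality using (_≡_; _≢_; refl; sym; trans)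
open import Relation.Unary using (_∈_; _∩_)

module _ {n : ℕ} {G : Graph n} where

  walk-head : ∀ {S u v} → Walk G S u v → u ∈ S
  walk-head (here p)     = p
  walk-head (step p _ _) = p

  walk-mono : ∀ {S T u v} → S ⊆ T → Walk G S u v → Walk G T u v
  walk-mono S⊆T (here p)     = here (S⊆T _ p)
  walk-mono S⊆T (step p a r) = step (S⊆T _ p) a (walk-mono S⊆T r)

  _++ʷ_ : ∀ {S u v w} → Walk G S u v → Walk G S v w → Walk G S u w
  here _     ++ʷ r′ = r′
  step p a r ++ʷ r′ = step p a (r ++ʷ r′)

  walk-snoc : ∀ {S u v w} → Walk G S u v → adj G v w ≡ true → w ∈ S → Walk G S u w
  walk-snoc (here p)     b q = step p b (here q)
  walk-snoc (step p a r) b q = step p a (walk-snoc r b q)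

  walk-reverse : ∀ {S u v} → Walk G S u v → Walk G S v u
  walk-reverse (here p)     = here p
  walk-reverse (step p a r) = walk-snoc (walk-reverse r) (adj-sym G _ _ a) p

module Separation {n k : ℕ} (G : Graph n) (s₁ s₂ : Fin n)
  (comp : Fin n → Fin k) (labelling : IsComponentLabelling G s₁ s₂ k comp) where

  Separator : VSet n
  Separator v = v ≡ s₁ ⊎ v ≡ s₂

  Comp⁺ : Fin k → VSet n
  Comp⁺ j v = v ∈ Comp s₁ s₂ comp j ⊎ v ∈ Separator

  same-comp-of-walk : ∀ {u v} → u ∈ Rest s₁ s₂ → v ∈ Rest s₁ s₂ →
                      Walk G (Rest s₁ s₂) u v → comp u ≡ comp v
  same-comp-of-walk uR vR = proj₂ (proj₂ labelling _ _ uR vR)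

  connected-avoiding-separator⊆Comp : ∀ {S} → Connected G S → S ⊆ Rest s₁ s₂ →
                                      ∃[ j ] (S ⊆ Comp s₁ s₂ comp j)
  connected-avoiding-separator⊆Comp ((v₀ , v₀S) , linked) S⊆R =
    comp v₀ , λ v vS → S⊆R v vS ,
      sym (same-comp-of-walk (S⊆R v₀ v₀S) (S⊆R v vS) (walk-mono S⊆R (linked v₀ v v₀S vS)))

  Comp-step : ∀ {j y w} → y ∈ Comp s₁ s₂ comp j → adj G y w ≡ true →
              w ∈ Rest s₁ s₂ → w ∈ Comp s₁ s₂ comp j
  Comp-step (yR , yj) a wR = wR , trans (sym (same-comp-of-walk yR wR (step yR a (here wR)))) yj

  ReachesSeparatorIn : VSet n → Fin k → Fin n → Set
  ReachesSeparatorIn T j y = ∃[ s ] (s ∈ Separator × s ∈ T × Walk G (T ∩ Comp⁺ j) y s)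

  walk-exits-Comp-via-Separator : ∀ {T j y t} → y ∈ Comp s₁ s₂ comp j → t ∈ Separator →
                                  Walk G T y t → ReachesSeparatorIn T j y
  walk-exits-Comp-via-Separator ((y≢s₁ , _) , _) (inj₁ refl) (here _) = ⊥-elim (y≢s₁ refl)
  walk-exits-Comp-via-Separator ((_ , y≢s₂) , _) (inj₂ refl) (here _) = ⊥-elim (y≢s₂ refl)
  walk-exits-Comp-via-Separator yC tS (step {w = w} yT a r) with w ≟ s₁ | w ≟ s₂
  ... | yes w≡s₁ | _ =
    w , inj₁ w≡s₁ , walk-head r , step (yT , inj₁ yC) a (here (walk-head r , inj₂ (inj₁ w≡s₁)))
  ... | no _ | yes w≡s₂ =
    w , inj₂ w≡s₂ , walk-head r , step (yT , inj₁ yC) a (here (walk-head r , inj₂ (inj₂ w≡s₂)))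
  ... | no w≢s₁ | no w≢s₂
    with s , sS , sT , rest ← walk-exits-Comp-via-Separator (Comp-step yC a (w≢s₁ , w≢s₂)) tS r
    = s , sS , sT , step (yT , inj₁ yC) a rest

  reaches-Separator : ∀ {T j t} → AllLinked G T → t ∈ Separator → t ∈ T →
                      ∀ y → y ∈ T ∩ Comp⁺ j → ReachesSeparatorIn T j y
  reaches-Separator linked tS tT y (yT , inj₁ yC) =
    walk-exits-Comp-via-Separator yC tS (linked y _ yT tT)
  reaches-Separator linked tS tT y (yT , inj₂ yS) = y , yS , yT , here (yT , inj₂ yS)

  module _ (s₁s₂ : adj G s₁ s₂ ≡ true) where

    Separator-linked : ∀ {T j s s′} → s ∈ Separator → s′ ∈ Separator → s ∈ T → s′ ∈ T →
                       Walk G (T ∩ Comp⁺ j) s s′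
    Separator-linked (inj₁ refl) (inj₁ refl) sT _   = here (sT , inj₂ (inj₁ refl))
    Separator-linked (inj₂ refl) (inj₂ refl) sT _   = here (sT , inj₂ (inj₂ refl))
    Separator-linked (inj₁ refl) (inj₂ refl) sT s′T =
      step (sT , inj₂ (inj₁ refl)) s₁s₂ (here (s′T , inj₂ (inj₂ refl)))
    Separator-linked (inj₂ refl) (inj₁ refl) sT s′T =
      step (sT , inj₂ (inj₂ refl)) (adj-sym G _ _ s₁s₂) (here (s′T , inj₂ (inj₁ refl)))

    ∩Comp⁺-linked : ∀ {T j t} → AllLinked G T → t ∈ Separator → t ∈ T →
                    AllLinked G (T ∩ Comp⁺ j)
    ∩Comp⁺-linked linked tS tT y z yA zA
      with s , sS , sT , y⇝s ← reaches-Separator linked tS tT y yA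
         | s′ , s′S , s′T , z⇝s′ ← reaches-Separator linked tS tT z zA
      = y⇝s ++ʷ (Separator-linked sS s′S sT s′T ++ʷ walk-reverse z⇝s′)

    s₁≢s₂ : s₁ ≢ s₂
    s₁≢s₂ refl = irrefl G s₁ s₁s₂

    minus-meets-Separator : ∀ {T} x → s₁ ∈ T → s₂ ∈ T →
                            ∃[ t ] (t ∈ Separator × t ∈ T -ᵥ x)
    minus-meets-Separator x s₁T s₂T with s₁ ≟ x
    ... | yes refl = s₂ , inj₂ refl , s₂T , λ s₂≡s₁ → s₁≢s₂ (sym s₂≡s₁)
    ... | no s₁≢x  = s₁ , inj₁ refl , s₁T , s₁≢x

    ∩Comp⁺-biconnected : ∀ {T} j → Biconnected G T → s₁ ∈ T → s₂ ∈ T →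
                         Biconnected G (T ∩ Comp⁺ j)
    ∩Comp⁺-biconnected {T} j ((_ , linked) , noArt) s₁T s₂T =
      ((s₁ , s₁T , inj₂ (inj₁ refl)) , ∩Comp⁺-linked linked (inj₁ refl) s₁T) ,
      λ x (xA , notLinked) → noArt x (proj₁ xA , λ linked-x → notLinked (minus-linked x linked-x))
      where
      minus-linked : ∀ x → AllLinked G (T -ᵥ x) → AllLinked G ((T ∩ Comp⁺ j) -ᵥ x)
      minus-linked x linked-x u v ((uT , uW) , u≢x) ((vT , vW) , v≢x)
        with t , tS , tT ← minus-meets-Separator x s₁T s₂T
        = walk-mono (λ y ((yT , y≢x) , yW) → (yT , yW) , y≢x)
            (∩Comp⁺-linked linked-x tS tT u v ((uT , u≢x) , uW) ((vT , v≢x) , vW))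

lemma2 : (n : ℕ) → 6 ≤ n → (G : Graph n) → Biconnected G Univ →
    (s₁ s₂ : Fin n) → adj G s₁ s₂ ≡ true →
    (k : ℕ) → (comp : Fin n → Fin k) → IsComponentLabelling G s₁ s₂ k comp → 2 < k →
    (V₁ V₂ : VSet n) → (∀ v → v ∈ V₁ ⊎ v ∈ V₂) → Disjoint V₁ V₂ →
    Biconnected G V₁ → Biconnected G V₂ → s₁ ∈ V₁ → s₂ ∈ V₁ →
    ∃[ j ] ((∀ i → i ≢ j → Comp s₁ s₂ comp i ⊆ V₁) ×
    (V₂ ⊆ Comp s₁ s₂ comp j) ×
    (((V₁ ≐ (λ v → (∃[ i ] (i ≢ j × v ∈ Comp s₁ s₂ comp i)) ⊎ v ≡ s₁ ⊎ v ≡ s₂)) ×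
    Biconnected G V₁ ×
    (V₂ ≐ Comp s₁ s₂ comp j) × Biconnected G (Comp s₁ s₂ comp j))
    ⊎
    (Σ (VSet n) λ A → Σ (VSet n) λ B →
    Disjoint A B ×
    ((λ v → v ∈ A ⊎ v ∈ B) ≐ (λ v → v ∈ Comp s₁ s₂ comp j ⊎ v ≡ s₁ ⊎ v ≡ s₂)) ×
    Biconnected G A × Biconnected G B ×
    (B ≐ V₂) × s₁ ∈ A × s₂ ∈ A)))
lemma2 n _ G _ s₁ s₂ s₁s₂ k comp labelling _ V₁ V₂ cover disjoint V₁-bic V₂-bic s₁V₁ s₂V₁
  = j , others⊆V₁ , V₂⊆Cⱼ ,
    inj₂ (V₁ ∩ Comp⁺ j , V₂ , (λ v vA → disjoint v (proj₁ vA)) , union ,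
          ∩Comp⁺-biconnected s₁s₂ j V₁-bic s₁V₁ s₂V₁ , V₂-bic ,
          ((λ _ p → p) , (λ _ p → p)) , (s₁V₁ , inj₂ (inj₁ refl)) , (s₂V₁ , inj₂ (inj₂ refl)))
  where
  open Separation G s₁ s₂ comp labelling

  V₂-avoids-Separator : V₂ ⊆ Rest s₁ s₂
  V₂-avoids-Separator v vV₂ = (λ { refl → disjoint v s₁V₁ vV₂ }) , (λ { refl → disjoint v s₂V₁ vV₂ })

  V₂-in-one-Comp : ∃[ j ] (V₂ ⊆ Comp s₁ s₂ comp j)
  V₂-in-one-Comp = connected-avoiding-separator⊆Comp (proj₁ V₂-bic) V₂-avoids-Separator

  j : Fin k
  j = proj₁ V₂-in-one-Comp

  V₂⊆Cⱼ : V₂ ⊆ Comp s₁ s₂ comp j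
  V₂⊆Cⱼ = proj₂ V₂-in-one-Comp

  others⊆V₁ : ∀ i → i ≢ j → Comp s₁ s₂ comp i ⊆ V₁
  others⊆V₁ i i≢j v (_ , vi) with cover v
  ... | inj₁ vV₁ = vV₁
  ... | inj₂ vV₂ = ⊥-elim (i≢j (trans (sym vi) (proj₂ (V₂⊆Cⱼ v vV₂))))

  union : (λ v → v ∈ V₁ ∩ Comp⁺ j ⊎ v ∈ V₂) ≐ Comp⁺ j
  union = (λ { v (inj₁ (_ , vW)) → vW ; v (inj₂ vV₂) → inj₁ (V₂⊆Cⱼ v vV₂) }) ,
          λ v vW → map₁ (_, vW) (cover v)
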